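{- Let $G$ be a middle-less graph with no $K_{1,1,3}$ minor and no $K_1 \cup K_{2,3}$ minor, let $S$ be a spanning subgraph of $G$ that is a subdivision of $K_{2,3}$, with terminal paths $P_1,P_2,P_3$, and suppose $G[P_1 \cup P_2]$ has an edge $e$ that is neither an edge of $P_1$ nor an edge of $P_2$. Then (i) either every edge of $G[P_2 \cup P_3]$ is an edge of $P_2 \cup P_3$, or every edge of $G[P_3 \cup P_1]$ is an edge of $P_1 \cup P_3$; and (ii) $e$ is the only edge of $G[P_1 \cup P_2]$ that is not an edge of $P_1$, $P_2$ or $P_3$.
   Context: A subdivision of a graph is obtained by repeatedly replacing an edge by a path of length 2 through a new vertex. For a subgraph $S$ of $G$ that is a subdivision of $K_{2,3}$, the terminal vertices are the two vertices $u,v$ of degree $3$ in $S$ and the terminal paths are the three $uv$-paths of $S$; $S$ is spanning if it contains all vertices of $G$. For a subgraph $H$ of $G$, $G[H]$ denotes the subgraph of $G$ induced by the vertex set of $H$. An inner vertex of a $uv$-path is a vertex other than $u,v$. Given a set $\mathcal{P}$ of paths in $G$, a path $P\in\mathcal{P}$ is a middle path if for every other $P'\in\mathcal{P}$ some edge of $G$ joins an inner vertex of $P$ to an inner vertex of $P'$. A graph $G$ containing a subdivision of $K_{2,3}$ is middle-less if, for every spanning subgraph of $G$ that is a subdivision of $K_{2,3}$, no terminal path is a middle path among its three terminal paths. $\cup$ in $K_1\cup K_{2,3}$ denotes disjoint union; minors are obtained by vertex/edge deletions and edge contractions. -}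

module Defs where

open import Data.Nat using (ℕ; zero; suc)
open import Data.Bool using (Bool; true; false; T)
open import Data.Fin using (Fin; zero; suc)
open import Data.List using (List; []; _∷_; _++_)
open import Data.List.Membership.Propositional using (_∈_; _∉_)
open import Data.List.Relation.Unary.Unique.Propositional using (Unique)
open import Data.List.Relation.Unary.Linked using (Linked)
open import Data.Maybe using (Maybe; just; nothing)
open import Data.Product using (Σ; ∃; ∃-syntax; _×_; _,_; proj₁; proj₂)
open import Data.Sum using (_⊎_; inj₁; inj₂)
open import Data.Empty using (⊥)
open import Relation.Nullary using (¬_)
open import Relation.Binary.PropositionalEquality using (_≡_; _≢_; refl; sym)

record Graph (n : ℕ) : Set₁ where
  field
    adj    : Fin n → Fin n → Set
    symm   : ∀ {x y} → adj x y → adj y x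
    irrefl : ∀ {x} → ¬ adj x x
open Graph public

-- Paths.  A uv-path is represented by the list of its inner vertices;
-- its full vertex sequence is  u ∷ inner ++ v ∷ [] .

fullPath : ∀ {n} → Fin n → Fin n → List (Fin n) → List (Fin n)
fullPath u v inner = u ∷ inner ++ v ∷ []

IsPath : ∀ {n} → Graph n → Fin n → Fin n → List (Fin n) → Set
IsPath G u v inner =
  Linked (adj G) (fullPath u v inner) × Unique (fullPath u v inner)

EdgeOfSeq : ∀ {n} → List (Fin n) → Fin n → Fin n → Set
EdgeOfSeq xs x y =
  (∃[ pre ] ∃[ suf ] xs ≡ pre ++ x ∷ y ∷ suf)
  ⊎ (∃[ pre ] ∃[ suf ] xs ≡ pre ++ y ∷ x ∷ suf)

-- Each terminal
-- path contains (at least) one inner vertex, namely the subdivided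
-- degree-2 vertex of K_{2,3}; distinct paths are internally disjoint.

record K23Subdiv {n : ℕ} (G : Graph n) : Set where
  field
    u v      : Fin n
    inner    : Fin 3 → List (Fin n)
    isPath   : ∀ i → IsPath G u v (inner i)
    nonEmpty : ∀ i → inner i ≢ []
    disjoint : ∀ i j → i ≢ j → ∀ x → x ∈ inner i → x ∉ inner j
open K23Subdiv public

tpath : ∀ {n} {G : Graph n} → K23Subdiv G → Fin 3 → List (Fin n)
tpath S i = fullPath (u S) (v S) (inner S i)

Spanning : ∀ {n} {G : Graph n} → K23Subdiv G → Set
Spanning {n} S = ∀ (x : Fin n) → x ≡ u S ⊎ x ≡ v S ⊎ ∃[ i ] x ∈ inner S i

IsMiddle : ∀ {n} {G : Graph n} → K23Subdiv G → Fin 3 → Set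
IsMiddle {G = G} S i =
  ∀ j → j ≢ i → ∃[ x ] ∃[ y ] x ∈ inner S i × y ∈ inner S j × adj G x y

MiddleLess : ∀ {n} → Graph n → Set
MiddleLess G =
  K23Subdiv G
  × (∀ (S : K23Subdiv G) → Spanning S → ∀ i → ¬ IsMiddle S i)

-- Minors, via branch sets: H is a minor of G iff there is a partial map
-- f : V(G) → V(H) whose fibres (branch sets) are nonempty and connected
-- in G, and such that every edge of H is realized by an edge of G
-- between the corresponding branch sets.

data ConnIn {n} (G : Graph n) (B : Fin n → Set) : Fin n → Fin n → Set where
  here : ∀ {x} → ConnIn G B x x
  step : ∀ {x y z} → adj G x y → B y → ConnIn G B y z → ConnIn G B x z

record MinorModel {m n : ℕ} (H : Graph m) (G : Graph n) : Set where
  field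
    branch    : Fin n → Maybe (Fin m)
    nonEmpty  : ∀ h → ∃[ x ] branch x ≡ just h
    connected : ∀ h x y → branch x ≡ just h → branch y ≡ just h →
                ConnIn G (λ z → branch z ≡ just h) x y
    edges     : ∀ h h' → adj H h h' →
                ∃[ x ] ∃[ y ] branch x ≡ just h × branch y ≡ just h' × adj G x y

IsMinor : ∀ {m n} → Graph m → Graph n → Set
IsMinor H G = MinorModel H G

-- Complete multipartite graphs (plus isolated vertices), given a part
-- label for each vertex and a flag saying whether it is non-isolated.

multipartite : ∀ {m} → (Fin m → ℕ) → (Fin m → Bool) → Graph m
multipartite part act = record
  { adj    = λ x y → T (act x) × T (act y) × part x ≢ part y
  ; symm   = λ { (a , b , d) → b , a , λ e → d (sym e) }
  ; irrefl = λ { (_ , _ , d) → d refl }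
  }

K113 : Graph 5
K113 = multipartite part (λ _ → true)
  where
  part : Fin 5 → ℕ
  part zero       = 0
  part (suc zero) = 1
  part _          = 2

K1∪K23 : Graph 6
K1∪K23 = multipartite part act
  where
  part : Fin 6 → ℕ
  part zero             = 0
  part (suc zero)       = 1
  part (suc (suc zero)) = 1
  part _                = 2
  act : Fin 6 → Bool
  act zero    = false
  act (suc _) = true

InPaths : ∀ {n} {G : Graph n} → K23Subdiv G → Fin 3 → Fin 3 → Fin n → Set
InPaths S i j x = x ∈ tpath S i ⊎ x ∈ tpath S j

InducedIsUnion : ∀ {n} {G : Graph n} → K23Subdiv G → Fin 3 → Fin 3 → Set
InducedIsUnion {n} {G} S i j =
  ∀ (x y : Fin n) → adj G x y → InPaths S i j x → InPaths S i j y →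
  EdgeOfSeq (tpath S i) x y ⊎ EdgeOfSeq (tpath S j) x y

module Submission where

-- A chord pq of a terminal path P (an edge between vertices p, q of P that are not
-- consecutive on P) gives a K₁,₁,₃ minor: the parts of P up to p and from q on are the two
-- adjacent hubs, and the inner vertices of P between p and q and the two other terminal paths
-- are the remaining three branch sets.  So the terminal paths are induced, and an edge of
-- G[Pᵢ ∪ Pⱼ] that is not an edge of Pᵢ or Pⱼ joins inner vertices of Pᵢ and Pⱼ.  Such a cross
-- edge between P₁ and P₂ together with one between P₂ and P₃ would make P₂ a middle path, which
-- gives (i).  For (ii), two distinct cross edges between P₁ and P₂ either cross, which yields a
-- K₁ ∪ K₂,₃ minor, or are parallel or share an end.  In the last two cases either some inner
-- vertex is left over to be the K₁ of a K₁ ∪ K₂,₃ minor, or rerouting the terminal paths along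
-- the two cross edges produces a spanning subdivision of K₂,₃ with a middle path.

open import Defs
open import Function using (_∘_)
open import Data.Nat using (ℕ; zero; suc)
open import Data.Fin using (Fin; zero; suc)
open import Data.Fin.Properties using (_≟_; any?)
open import Data.Product using (∃-syntax; _×_; _,_; proj₁; proj₂; swap)
open import Data.Sum using (_⊎_; inj₁; inj₂; [_,_]′)
open import Data.Empty using (⊥; ⊥-elim)
open import Data.Maybe using (Maybe; just; nothing)
open import Data.List using (List; []; _∷_; _++_; [_]; reverse; concat; tabulate)
import Data.List.Properties as List
open import Data.List.Membership.Propositional using (_∈_; _∉_)
open import Data.List.Membership.Propositional.Properties
  using (∈-++⁺ˡ; ∈-++⁺ʳ; ∈-++⁻; ∈-∃++; ∈-concat⁺′; ∈-tabulate⁺)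
import Data.List.Membership.DecPropositional as DecMembership
open import Data.List.Relation.Unary.Any using (here; there)
import Data.List.Relation.Unary.All as All
open import Data.List.Relation.Unary.All using ([]; _∷_)
import Data.List.Relation.Unary.All.Properties as All
open import Data.List.Relation.Unary.AllPairs using ([]; _∷_)
open import Data.List.Relation.Unary.Unique.Propositional using (Unique)
import Data.List.Relation.Unary.Unique.Propositional.Properties as Unique
open import Data.List.Relation.Unary.Linked as Linked using (Linked; []; [-]; _∷_)
open import Data.List.Relation.Binary.Permutation.Propositional using (_↭_; ↭-refl; ↭-sym; ↭-trans; ↭⇒↭ₛ; prep)
open import Data.List.Relation.Binary.Permutation.Propositional.Properties
  using (∈-resp-↭; ↭-reverse; ++-commutativeMonoid; ++⁺ˡ)
import Data.List.Relation.Binary.Permutation.Setoid.Properties as PermutationSetoid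
open import Relation.Nullary using (¬_; yes; no)
open import Relation.Binary.PropositionalEquality using (_≡_; _≢_; refl; sym; trans; cong; subst; setoid)

module _ {A : Set} where

  Unique-resp-↭ : ∀ {xs ys : List A} → xs ↭ ys → Unique xs → Unique ys
  Unique-resp-↭ p = PermutationSetoid.Unique-resp-↭ (setoid A) (↭⇒↭ₛ p)

  Unique-++⁻ˡ : ∀ (xs : List A) {ys} → Unique (xs ++ ys) → Unique xs
  Unique-++⁻ˡ []       _       = []
  Unique-++⁻ˡ (x ∷ xs) (a ∷ u) = All.++⁻ˡ xs a ∷ Unique-++⁻ˡ xs u

  Unique-++⁻ʳ : ∀ (xs : List A) {ys} → Unique (xs ++ ys) → Unique ys
  Unique-++⁻ʳ []       u       = u
  Unique-++⁻ʳ (x ∷ xs) (_ ∷ u) = Unique-++⁻ʳ xs u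

  Unique-++⇒disjoint : ∀ (xs : List A) {ys z} → Unique (xs ++ ys) → z ∈ xs → z ∉ ys
  Unique-++⇒disjoint (x ∷ xs) (a ∷ u) (here refl) q = All.lookup (All.++⁻ʳ xs a) q refl
  Unique-++⇒disjoint (x ∷ xs) (a ∷ u) (there p)   q = Unique-++⇒disjoint xs u p q

  record Ordered (xs : List A) (x y : A) : Set where
    constructor ordered
    field
      before between after : List A
      split : xs ≡ before ++ x ∷ between ++ y ∷ after

  ∈-ordered : ∀ (xs : List A) {x y} → x ∈ xs → y ∈ xs → x ≢ y → Ordered xs x y ⊎ Ordered xs y x
  ∈-ordered (z ∷ zs) (here refl) (here refl) x≢y = ⊥-elim (x≢y refl)
  ∈-ordered (z ∷ zs) (here refl) (there q)   _   with ∈-∃++ q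
  ... | B , C , eq = inj₁ (ordered [] B C (cong (z ∷_) eq))
  ∈-ordered (z ∷ zs) (there p)   (here refl) _   with ∈-∃++ p
  ... | B , C , eq = inj₂ (ordered [] B C (cong (z ∷_) eq))
  ∈-ordered (z ∷ zs) (there p)   (there q)   x≢y with ∈-ordered zs p q x≢y
  ... | inj₁ (ordered P Q R eq) = inj₁ (ordered (z ∷ P) Q R (cong (z ∷_) eq))
  ... | inj₂ (ordered P Q R eq) = inj₂ (ordered (z ∷ P) Q R (cong (z ∷_) eq))

  ∈-++-∷⁺ˡ : ∀ (xs : List A) {y ys z} → z ∈ xs ++ [ y ] → z ∈ xs ++ y ∷ ys
  ∈-++-∷⁺ˡ xs z∈ with ∈-++⁻ xs z∈
  ... | inj₁ p         = ∈-++⁺ˡ p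
  ... | inj₂ (here eq) = ∈-++⁺ʳ xs (here eq)

  ∈-++-∷⁺ʳ : ∀ (xs : List A) {y ys z} → z ∈ ys ++ [ y ] → z ∈ xs ++ y ∷ ys
  ∈-++-∷⁺ʳ xs {ys = ys} z∈ with ∈-++⁻ ys z∈
  ... | inj₁ p         = ∈-++⁺ʳ xs (there p)
  ... | inj₂ (here eq) = ∈-++⁺ʳ xs (here eq)

  ++-∷≢[] : ∀ (xs : List A) {y ys} → xs ++ y ∷ ys ≢ []
  ++-∷≢[] []      ()
  ++-∷≢[] (_ ∷ _) ()

  head∈prefix : ∀ (xs : List A) {x y ys zs} → x ∷ ys ≡ xs ++ y ∷ zs → x ∈ xs ++ [ y ]
  head∈prefix []      refl = here refl
  head∈prefix (_ ∷ _) refl = here refl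

  last∈suffix : ∀ (xs ys : List A) {x y zs} → xs ++ [ x ] ≡ ys ++ y ∷ zs → x ∈ y ∷ zs
  last∈suffix xs       []           eq = subst (_ ∈_) eq (∈-++⁺ʳ xs (here refl))
  last∈suffix []       (_ ∷ [])     ()
  last∈suffix []       (_ ∷ _ ∷ _)  ()
  last∈suffix (_ ∷ xs) (_ ∷ ys)     eq = last∈suffix xs ys (List.∷-injectiveʳ eq)

  ++-∷-assoc : ∀ (xs : List A) x ys zs → (xs ++ x ∷ ys) ++ zs ≡ xs ++ x ∷ ys ++ zs
  ++-∷-assoc xs x ys = List.++-assoc xs (x ∷ ys)

module _ {A : Set} {R : A → A → Set} where

  Linked-++⁻ˡ : ∀ (xs : List A) {ys} → Linked R (xs ++ ys) → Linked R xs
  Linked-++⁻ˡ []           _       = []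
  Linked-++⁻ˡ (x ∷ [])     _       = [-]
  Linked-++⁻ˡ (x ∷ y ∷ xs) (r ∷ l) = r ∷ Linked-++⁻ˡ (y ∷ xs) l

  Linked-++⁻ʳ : ∀ (xs : List A) {ys} → Linked R (xs ++ ys) → Linked R ys
  Linked-++⁻ʳ []                    l       = l
  Linked-++⁻ʳ (x ∷ [])     {[]}     _       = []
  Linked-++⁻ʳ (x ∷ [])     {y ∷ ys} (_ ∷ l) = l
  Linked-++⁻ʳ (x ∷ y ∷ xs)          (_ ∷ l) = Linked-++⁻ʳ (y ∷ xs) l

  Linked-prefix : ∀ (xs : List A) {y ys} → Linked R (xs ++ y ∷ ys) → Linked R (xs ++ [ y ])
  Linked-prefix []           _       = [-]
  Linked-prefix (x ∷ [])     (r ∷ _) = r ∷ [-]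
  Linked-prefix (x ∷ y ∷ xs) (r ∷ l) = r ∷ Linked-prefix (y ∷ xs) l

  Linked-adjacent : ∀ (xs : List A) {x y ys} → Linked R (xs ++ x ∷ y ∷ ys) → R x y
  Linked-adjacent []       (r ∷ _) = r
  Linked-adjacent (_ ∷ xs) l       = Linked-adjacent xs (Linked.tail l)

  Linked-successor : ∀ (xs : List A) {x y ys} → Linked R (x ∷ xs ++ y ∷ ys) → ∃[ z ] z ∈ xs ++ [ y ] × R x z
  Linked-successor []       (r ∷ _) = _ , here refl , r
  Linked-successor (z ∷ xs) (r ∷ _) = z , here refl , r

  Linked-predecessor : ∀ (xs : List A) {x y ys} → Linked R (x ∷ xs ++ y ∷ ys) → ∃[ z ] z ∈ x ∷ xs × R z y
  Linked-predecessor []       (r ∷ _) = _ , here refl , r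
  Linked-predecessor (_ ∷ xs) (_ ∷ l) with Linked-predecessor xs l
  ... | z , z∈ , r = z , there z∈ , r

Walk : ∀ {A : Set} → (A → A → Set) → A → List A → A → Set
Walk R x xs y = Linked R (x ∷ xs ++ [ y ])

module _ {A : Set} {R : A → A → Set} where

  Walk-split : ∀ (xs : List A) {x y z ys} → Walk R x (xs ++ y ∷ ys) z → Walk R x xs y × Walk R y ys z
  Walk-split []       (r ∷ w) = r ∷ [-] , w
  Walk-split (_ ∷ xs) (r ∷ w) with Walk-split xs w
  ... | w₁ , w₂ = r ∷ w₁ , w₂

  Walk-join : ∀ (xs : List A) {x y z ys} → Walk R x xs y → Walk R y ys z → Walk R x (xs ++ y ∷ ys) z
  Walk-join []       (r ∷ _)  w₂ = r ∷ w₂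
  Walk-join (_ ∷ xs) (r ∷ w₁) w₂ = r ∷ Walk-join xs w₁ w₂

  Walk-inner : ∀ {x y} (xs : List A) → Walk R x xs y → Linked R xs
  Walk-inner xs w = Linked-++⁻ˡ xs (Linked.tail w)

  Walk-init : ∀ {x y} (xs : List A) → Walk R x xs y → Linked R (x ∷ xs)
  Walk-init {x} xs = Linked-++⁻ˡ (x ∷ xs)

  Walk-reverse : (∀ {x y} → R x y → R y x) → ∀ {x y xs} → Walk R x xs y → Walk R y (reverse xs) x
  Walk-reverse sym-R {xs = []}     (r ∷ [-]) = sym-R r ∷ [-]
  Walk-reverse sym-R {xs = z ∷ zs} (r ∷ w) rewrite List.unfold-reverse z zs =
    Walk-join (reverse zs) (Walk-reverse sym-R w) (sym-R r ∷ [-])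

  Walk-first : ∀ {x y} {xs : List A} → xs ≢ [] → Walk R x xs y → ∃[ z ] z ∈ xs × R x z
  Walk-first {xs = []}     xs≢[] _       = ⊥-elim (xs≢[] refl)
  Walk-first {xs = z ∷ xs} _     (r ∷ _) = z , here refl , r

  Walk-last : ∀ {x y} {xs : List A} → xs ≢ [] → Walk R x xs y → ∃[ z ] z ∈ xs × R z y
  Walk-last {xs = []}     xs≢[] _       = ⊥-elim (xs≢[] refl)
  Walk-last {xs = z ∷ xs} _     (_ ∷ l) = Linked-predecessor xs l

  Walk-split₂ : ∀ (xs ys : List A) {w x y z zs} → Walk R w (xs ++ x ∷ ys ++ y ∷ zs) z →
                Walk R w xs x × Walk R x ys y × Walk R y zs z
  Walk-split₂ xs ys p with Walk-split xs p
  ... | p₁ , p₂ = p₁ , Walk-split ys p₂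

module _ {n : ℕ} (G : Graph n) where

  open import Algebra.Solver.CommutativeMonoid (++-commutativeMonoid {A = Fin n}) using (solve; _⊜_; _⊕_)

  private
    _~_ : Fin n → Fin n → Set
    _~_ = adj G

  ConnIn-mono : ∀ {B B′ : Fin n → Set} → (∀ {z} → B z → B′ z) → ∀ {x y} → ConnIn G B x y → ConnIn G B′ x y
  ConnIn-mono f here         = here
  ConnIn-mono f (step e b c) = step e (f b) (ConnIn-mono f c)

  ConnIn-trans : ∀ {B x y z} → ConnIn G B x y → ConnIn G B y z → ConnIn G B x z
  ConnIn-trans here         d = d
  ConnIn-trans (step e b c) d = step e b (ConnIn-trans c d)

  ConnIn-sym : ∀ {B x y} → B x → ConnIn G B x y → ConnIn G B y x
  ConnIn-sym bx here         = here
  ConnIn-sym bx (step e b c) = ConnIn-trans (ConnIn-sym b c) (step (symm G e) bx here)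

  Connected : List (Fin n) → Set
  Connected B = ∀ {x y} → x ∈ B → y ∈ B → ConnIn G (_∈ B) x y

  Linked⇒Connected : ∀ {xs} → Linked _~_ xs → Connected xs
  Linked⇒Connected {x ∷ xs} l x′∈ y∈ = ConnIn-trans (ConnIn-sym (here refl) (from-head l x′∈)) (from-head l y∈)
    where
    from-head : ∀ {x xs z} → Linked _~_ (x ∷ xs) → z ∈ x ∷ xs → ConnIn G (_∈ x ∷ xs) x z
    from-head _       (here refl) = here
    from-head (e ∷ l) (there z∈)  = step e (there (here refl)) (ConnIn-mono there (from-head l z∈))

  Connected-∪ : ∀ {A B C a} → Connected A → Connected B → a ∈ A → a ∈ B →
                (∀ {z} → z ∈ C → z ∈ A ⊎ z ∈ B) → (∀ {z} → z ∈ A ⊎ z ∈ B → z ∈ C) → Connected C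
  Connected-∪ {A} {B} {C} {a} cA cB a∈A a∈B split join x∈ y∈ =
    ConnIn-trans (to-a (split x∈)) (from-a (split y∈))
    where
    to-a : ∀ {x} → x ∈ A ⊎ x ∈ B → ConnIn G (_∈ C) x a
    to-a (inj₁ x∈A) = ConnIn-mono (join ∘ inj₁) (cA x∈A a∈A)
    to-a (inj₂ x∈B) = ConnIn-mono (join ∘ inj₂) (cB x∈B a∈B)
    from-a : ∀ {y} → y ∈ A ⊎ y ∈ B → ConnIn G (_∈ C) a y
    from-a (inj₁ y∈A) = ConnIn-mono (join ∘ inj₁) (cA a∈A y∈A)
    from-a (inj₂ y∈B) = ConnIn-mono (join ∘ inj₂) (cB a∈B y∈B)

  Connected-star : ∀ {a xs ys} → Connected (a ∷ xs) → Connected (a ∷ ys) → Connected (a ∷ xs ++ ys)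
  Connected-star {a} {xs} {ys} cx cy = Connected-∪ cx cy (here refl) (here refl) split join
    where
    split : ∀ {z} → z ∈ a ∷ xs ++ ys → z ∈ a ∷ xs ⊎ z ∈ a ∷ ys
    split (here eq) = inj₁ (here eq)
    split (there z∈) with ∈-++⁻ xs z∈
    ... | inj₁ z∈xs = inj₁ (there z∈xs)
    ... | inj₂ z∈ys = inj₂ (there z∈ys)
    join : ∀ {z} → z ∈ a ∷ xs ⊎ z ∈ a ∷ ys → z ∈ a ∷ xs ++ ys
    join (inj₁ (here eq))    = here eq
    join (inj₁ (there z∈xs)) = there (∈-++⁺ˡ z∈xs)
    join (inj₂ (here eq))    = here eq
    join (inj₂ (there z∈ys)) = there (∈-++⁺ʳ xs z∈ys)

  Connected-meet : ∀ {a xs ys} → Connected (xs ++ [ a ]) → Connected (ys ++ [ a ]) → Connected (xs ++ a ∷ ys)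
  Connected-meet {a} {xs} {ys} cx cy =
    Connected-∪ cx cy (∈-++⁺ʳ xs (here refl)) (∈-++⁺ʳ ys (here refl)) split join
    where
    split : ∀ {z} → z ∈ xs ++ a ∷ ys → z ∈ xs ++ [ a ] ⊎ z ∈ ys ++ [ a ]
    split z∈ with ∈-++⁻ xs z∈
    ... | inj₁ z∈xs          = inj₁ (∈-++⁺ˡ z∈xs)
    ... | inj₂ (here eq)     = inj₁ (∈-++⁺ʳ xs (here eq))
    ... | inj₂ (there z∈ys)  = inj₂ (∈-++⁺ˡ z∈ys)
    join : ∀ {z} → z ∈ xs ++ [ a ] ⊎ z ∈ ys ++ [ a ] → z ∈ xs ++ a ∷ ys
    join (inj₁ z∈) = ∈-++-∷⁺ˡ xs z∈
    join (inj₂ z∈) = ∈-++-∷⁺ʳ xs z∈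

  Joined : List (Fin n) → List (Fin n) → Set
  Joined A B = ∃[ x ] ∃[ y ] x ∈ A × y ∈ B × x ~ y

  Joined-sym : ∀ {A B} → Joined A B → Joined B A
  Joined-sym (x , y , x∈ , y∈ , e) = y , x , y∈ , x∈ , symm G e

  Joined-monoʳ : ∀ {A B B′} → (∀ {z} → z ∈ B → z ∈ B′) → Joined A B → Joined A B′
  Joined-monoʳ B⊆B′ (x , y , x∈ , y∈ , e) = x , y , x∈ , B⊆B′ y∈ , e

  Walk⇒Joined-next : ∀ {A x xs y} → x ∈ A → Walk _~_ x xs y → Joined A (xs ++ [ y ])
  Walk⇒Joined-next {xs = xs} x∈ w with Linked-successor xs w
  ... | z , z∈ , e = _ , z , x∈ , z∈ , e

  Walk⇒Joined-prev : ∀ {A x xs y} → y ∈ A → Walk _~_ x xs y → Joined A (x ∷ xs)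
  Walk⇒Joined-prev {xs = xs} y∈ w with Linked-predecessor xs w
  ... | z , z∈ , e = _ , z , y∈ , z∈ , symm G e

  Walk⇒Joined-first : ∀ {A x xs y} → x ∈ A → xs ≢ [] → Walk _~_ x xs y → Joined A xs
  Walk⇒Joined-first x∈ xs≢[] w with Walk-first xs≢[] w
  ... | z , z∈ , e = _ , z , x∈ , z∈ , e

  Walk⇒Joined-last : ∀ {A x xs y} → y ∈ A → xs ≢ [] → Walk _~_ x xs y → Joined A xs
  Walk⇒Joined-last y∈ xs≢[] w with Walk-last xs≢[] w
  ... | z , z∈ , e = _ , z , y∈ , z∈ , symm G e

  concat-tabulate-disjoint : ∀ {m} (B : Fin m → List (Fin n)) → Unique (concat (tabulate B)) →
                             ∀ h h′ {x} → x ∈ B h → x ∈ B h′ → h ≡ h′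
  concat-tabulate-disjoint B U zero    zero     p q = refl
  concat-tabulate-disjoint B U zero    (suc h′) p q =
    ⊥-elim (Unique-++⇒disjoint (B zero) U p (∈-concat⁺′ q (∈-tabulate⁺ h′)))
  concat-tabulate-disjoint B U (suc h) zero     p q =
    ⊥-elim (Unique-++⇒disjoint (B zero) U q (∈-concat⁺′ p (∈-tabulate⁺ h)))
  concat-tabulate-disjoint B U (suc h) (suc h′) p q =
    cong suc (concat-tabulate-disjoint (B ∘ suc) (Unique-++⁻ʳ (B zero) U) h h′ p q)

  minor-from-branch-sets : ∀ {m} (H : Graph m) (B : Fin m → List (Fin n)) → Unique (concat (tabulate B)) →
                           (∀ h → Connected (B h)) → (∀ h → ∃[ x ] x ∈ B h) →
                           (∀ h h′ → adj H h h′ → Joined (B h) (B h′)) → IsMinor H G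
  minor-from-branch-sets {m} H B U connected inhabited joined = record
    { branch = branch ; nonEmpty = nonEmpty′ ; connected = connected′ ; edges = edges }
    where
    open DecMembership (_≟_ {n}) using (_∈?_)
    branch : Fin n → Maybe (Fin m)
    branch x with any? (λ h → x ∈? B h)
    ... | yes (h , _) = just h
    ... | no _        = nothing
    sound : ∀ {x h} → branch x ≡ just h → x ∈ B h
    sound {x} eq with any? (λ h → x ∈? B h)
    sound refl | yes (h , x∈) = x∈
    sound ()   | no _
    complete : ∀ {x h} → x ∈ B h → branch x ≡ just h
    complete {x} {h} x∈ with any? (λ h → x ∈? B h)
    ... | yes (h′ , x∈′) = cong just (concat-tabulate-disjoint B U h′ h x∈′ x∈)
    ... | no x∉          = ⊥-elim (x∉ (h , x∈))
    nonEmpty′ : ∀ h → ∃[ x ] branch x ≡ just h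
    nonEmpty′ h = proj₁ (inhabited h) , complete (proj₂ (inhabited h))
    connected′ : ∀ h x y → branch x ≡ just h → branch y ≡ just h → ConnIn G (λ z → branch z ≡ just h) x y
    connected′ h x y bx by = ConnIn-mono complete (connected h (sound bx) (sound by))
    edges : ∀ h h′ → adj H h h′ → ∃[ x ] ∃[ y ] branch x ≡ just h × branch y ≡ just h′ × x ~ y
    edges h h′ a with joined h h′ a
    ... | x , y , x∈ , y∈ , e = x , y , complete x∈ , complete y∈ , e

  K113-minor : ∀ {B₀ B₁ B₂ B₃ B₄} → Unique (B₀ ++ B₁ ++ B₂ ++ B₃ ++ B₄) →
    Connected B₀ → Connected B₁ → Connected B₂ → Connected B₃ → Connected B₄ →
    Joined B₀ B₁ → Joined B₀ B₂ → Joined B₀ B₃ → Joined B₀ B₄ →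
    Joined B₁ B₂ → Joined B₁ B₃ → Joined B₁ B₄ → IsMinor K113 G
  K113-minor {B₀} {B₁} {B₂} {B₃} {B₄} U c₀ c₁ c₂ c₃ c₄ j₀₁ j₀₂ j₀₃ j₀₄ j₁₂ j₁₃ j₁₄ =
    minor-from-branch-sets K113 B U′ connected inhabited joined
    where
    B : Fin 5 → List (Fin n)
    B zero                         = B₀
    B (suc zero)                   = B₁
    B (suc (suc zero))             = B₂
    B (suc (suc (suc zero)))       = B₃
    B (suc (suc (suc (suc zero)))) = B₄
    U′ : Unique (concat (tabulate B))
    U′ = subst (λ t → Unique (B₀ ++ B₁ ++ B₂ ++ B₃ ++ t)) (sym (List.++-identityʳ B₄)) U
    connected : ∀ h → Connected (B h)
    connected zero                         = c₀
    connected (suc zero)                   = c₁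
    connected (suc (suc zero))             = c₂
    connected (suc (suc (suc zero)))       = c₃
    connected (suc (suc (suc (suc zero)))) = c₄
    target : ∀ {A C} → Joined A C → ∃[ y ] y ∈ C
    target (_ , y , _ , y∈ , _) = y , y∈
    inhabited : ∀ h → ∃[ x ] x ∈ B h
    inhabited zero                         = target (Joined-sym j₀₁)
    inhabited (suc zero)                   = target j₀₁
    inhabited (suc (suc zero))             = target j₀₂
    inhabited (suc (suc (suc zero)))       = target j₀₃
    inhabited (suc (suc (suc (suc zero)))) = target j₀₄
    joined : ∀ h h′ → adj K113 h h′ → Joined (B h) (B h′)
    joined zero                         (suc zero)                   _ = j₀₁
    joined zero                         (suc (suc zero))             _ = j₀₂
    joined zero                         (suc (suc (suc zero)))       _ = j₀₃
    joined zero                         (suc (suc (suc (suc zero)))) _ = j₀₄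
    joined (suc zero)                   (suc (suc zero))             _ = j₁₂
    joined (suc zero)                   (suc (suc (suc zero)))       _ = j₁₃
    joined (suc zero)                   (suc (suc (suc (suc zero)))) _ = j₁₄
    joined (suc zero)                   zero                         _ = Joined-sym j₀₁
    joined (suc (suc zero))             zero                         _ = Joined-sym j₀₂
    joined (suc (suc (suc zero)))       zero                         _ = Joined-sym j₀₃
    joined (suc (suc (suc (suc zero)))) zero                         _ = Joined-sym j₀₄
    joined (suc (suc zero))             (suc zero)                   _ = Joined-sym j₁₂
    joined (suc (suc (suc zero)))       (suc zero)                   _ = Joined-sym j₁₃
    joined (suc (suc (suc (suc zero)))) (suc zero)                   _ = Joined-sym j₁₄
    joined zero                         zero                         (_ , _ , d) = ⊥-elim (d refl)
    joined (suc zero)                   (suc zero)                   (_ , _ , d) = ⊥-elim (d refl)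
    joined (suc (suc _))                (suc (suc _))                (_ , _ , d) = ⊥-elim (d refl)

  K1∪K23-minor : ∀ {B₀ B₁ B₂ B₃ B₄ B₅ b} → Unique (B₀ ++ B₁ ++ B₂ ++ B₃ ++ B₄ ++ B₅) → b ∈ B₀ →
    Connected B₀ → Connected B₁ → Connected B₂ → Connected B₃ → Connected B₄ → Connected B₅ →
    Joined B₁ B₃ → Joined B₁ B₄ → Joined B₁ B₅ → Joined B₂ B₃ → Joined B₂ B₄ → Joined B₂ B₅ →
    IsMinor K1∪K23 G
  K1∪K23-minor {B₀} {B₁} {B₂} {B₃} {B₄} {B₅} {b} U b∈ c₀ c₁ c₂ c₃ c₄ c₅ j₁₃ j₁₄ j₁₅ j₂₃ j₂₄ j₂₅ =
    minor-from-branch-sets K1∪K23 B U′ connected inhabited joined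
    where
    B : Fin 6 → List (Fin n)
    B zero                               = B₀
    B (suc zero)                         = B₁
    B (suc (suc zero))                   = B₂
    B (suc (suc (suc zero)))             = B₃
    B (suc (suc (suc (suc zero))))       = B₄
    B (suc (suc (suc (suc (suc zero))))) = B₅
    U′ : Unique (concat (tabulate B))
    U′ = subst (λ t → Unique (B₀ ++ B₁ ++ B₂ ++ B₃ ++ B₄ ++ t)) (sym (List.++-identityʳ B₅)) U
    connected : ∀ h → Connected (B h)
    connected zero                               = c₀
    connected (suc zero)                         = c₁
    connected (suc (suc zero))                   = c₂
    connected (suc (suc (suc zero)))             = c₃
    connected (suc (suc (suc (suc zero))))       = c₄
    connected (suc (suc (suc (suc (suc zero))))) = c₅
    target : ∀ {A C} → Joined A C → ∃[ y ] y ∈ C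
    target (_ , y , _ , y∈ , _) = y , y∈
    inhabited : ∀ h → ∃[ x ] x ∈ B h
    inhabited zero                               = b , b∈
    inhabited (suc zero)                         = target (Joined-sym j₁₃)
    inhabited (suc (suc zero))                   = target (Joined-sym j₂₃)
    inhabited (suc (suc (suc zero)))             = target j₁₃
    inhabited (suc (suc (suc (suc zero))))       = target j₁₄
    inhabited (suc (suc (suc (suc (suc zero))))) = target j₁₅
    joined : ∀ h h′ → adj K1∪K23 h h′ → Joined (B h) (B h′)
    joined (suc zero)                         (suc (suc (suc zero)))             _ = j₁₃
    joined (suc zero)                         (suc (suc (suc (suc zero))))       _ = j₁₄
    joined (suc zero)                         (suc (suc (suc (suc (suc zero))))) _ = j₁₅
    joined (suc (suc zero))                   (suc (suc (suc zero)))             _ = j₂₃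
    joined (suc (suc zero))                   (suc (suc (suc (suc zero))))       _ = j₂₄
    joined (suc (suc zero))                   (suc (suc (suc (suc (suc zero))))) _ = j₂₅
    joined (suc (suc (suc zero)))             (suc zero)                         _ = Joined-sym j₁₃
    joined (suc (suc (suc (suc zero))))       (suc zero)                         _ = Joined-sym j₁₄
    joined (suc (suc (suc (suc (suc zero))))) (suc zero)                         _ = Joined-sym j₁₅
    joined (suc (suc (suc zero)))             (suc (suc zero))                   _ = Joined-sym j₂₃
    joined (suc (suc (suc (suc zero))))       (suc (suc zero))                   _ = Joined-sym j₂₄
    joined (suc (suc (suc (suc (suc zero))))) (suc (suc zero))                   _ = Joined-sym j₂₅
    joined zero                               _                                  (() , _)
    joined (suc _)                            zero                               (_ , () , _)
    joined (suc zero)                         (suc zero)                         (_ , _ , d) = ⊥-elim (d refl)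
    joined (suc zero)                         (suc (suc zero))                   (_ , _ , d) = ⊥-elim (d refl)
    joined (suc (suc zero))                   (suc zero)                         (_ , _ , d) = ⊥-elim (d refl)
    joined (suc (suc zero))                   (suc (suc zero))                   (_ , _ , d) = ⊥-elim (d refl)
    joined (suc (suc (suc _)))                (suc (suc (suc _)))                (_ , _ , d) = ⊥-elim (d refl)

  -- A spanning subdivision of K₂,₃ listing every vertex exactly once, so that rerouting its
  -- terminal paths only has to be justified by a permutation of that list.
  record SpanningTheta (u v : Fin n) (I₀ I₁ I₂ : List (Fin n)) : Set where
    field
      path₀ : Walk _~_ u I₀ v
      path₁ : Walk _~_ u I₁ v
      path₂ : Walk _~_ u I₂ v
      I₀≢[] : I₀ ≢ []
      I₁≢[] : I₁ ≢ []
      I₂≢[] : I₂ ≢ []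
      unique : Unique (u ∷ v ∷ I₀ ++ I₁ ++ I₂)
      covers : ∀ x → x ∈ u ∷ v ∷ I₀ ++ I₁ ++ I₂

  module _ {u v I₀ I₁ I₂} (θ : SpanningTheta u v I₀ I₁ I₂) where
    open SpanningTheta θ

    unique-path₀-first : Unique ((u ∷ I₀ ++ [ v ]) ++ I₁ ++ I₂)
    unique-path₀-first = Unique-resp-↭
      (solve 5 (λ u v a b c → u ⊕ (v ⊕ (a ⊕ (b ⊕ c))) ⊜ (u ⊕ (a ⊕ v)) ⊕ (b ⊕ c)) ↭-refl [ u ] [ v ] I₀ I₁ I₂)
      unique

    private
      I : Fin 3 → List (Fin n)
      I zero             = I₀
      I (suc zero)       = I₁
      I (suc (suc zero)) = I₂

      path-unique : ∀ i → Unique (u ∷ I i ++ [ v ])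
      path-unique zero = Unique-++⁻ˡ (u ∷ I₀ ++ [ v ]) unique-path₀-first
      path-unique (suc zero) = Unique-++⁻ˡ (u ∷ I₁ ++ [ v ]) (Unique-resp-↭
        (solve 5 (λ u v a b c → u ⊕ (v ⊕ (a ⊕ (b ⊕ c))) ⊜ (u ⊕ (b ⊕ v)) ⊕ (a ⊕ c)) ↭-refl [ u ] [ v ] I₀ I₁ I₂)
        unique)
      path-unique (suc (suc zero)) = Unique-++⁻ˡ (u ∷ I₂ ++ [ v ]) (Unique-resp-↭
        (solve 5 (λ u v a b c → u ⊕ (v ⊕ (a ⊕ (b ⊕ c))) ⊜ (u ⊕ (c ⊕ v)) ⊕ (a ⊕ b)) ↭-refl [ u ] [ v ] I₀ I₁ I₂)
        unique)

      inner-unique : Unique (I₀ ++ I₁ ++ I₂)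
      inner-unique = Unique-++⁻ʳ (u ∷ v ∷ []) unique

      inner-disjoint : ∀ i j → i ≢ j → ∀ x → x ∈ I i → x ∉ I j
      inner-disjoint zero zero i≢j _ _ _ = i≢j refl
      inner-disjoint (suc zero) (suc zero) i≢j _ _ _ = i≢j refl
      inner-disjoint (suc (suc zero)) (suc (suc zero)) i≢j _ _ _ = i≢j refl
      inner-disjoint zero (suc zero) _ _ p q = Unique-++⇒disjoint I₀ inner-unique p (∈-++⁺ˡ q)
      inner-disjoint zero (suc (suc zero)) _ _ p q = Unique-++⇒disjoint I₀ inner-unique p (∈-++⁺ʳ I₁ q)
      inner-disjoint (suc zero) zero _ _ p q = Unique-++⇒disjoint I₀ inner-unique q (∈-++⁺ˡ p)
      inner-disjoint (suc (suc zero)) zero _ _ p q = Unique-++⇒disjoint I₀ inner-unique q (∈-++⁺ʳ I₁ p)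
      inner-disjoint (suc zero) (suc (suc zero)) _ _ p q = Unique-++⇒disjoint I₁ (Unique-++⁻ʳ I₀ inner-unique) p q
      inner-disjoint (suc (suc zero)) (suc zero) _ _ p q = Unique-++⇒disjoint I₁ (Unique-++⁻ʳ I₀ inner-unique) q p

    subdivision : K23Subdiv G
    subdivision = record
      { u = u ; v = v ; inner = I ; isPath = path ; nonEmpty = I≢[] ; disjoint = inner-disjoint }
      where
      path : ∀ i → IsPath G u v (I i)
      path zero             = path₀ , path-unique zero
      path (suc zero)       = path₁ , path-unique (suc zero)
      path (suc (suc zero)) = path₂ , path-unique (suc (suc zero))
      I≢[] : ∀ i → I i ≢ []
      I≢[] zero             = I₀≢[]
      I≢[] (suc zero)       = I₁≢[]
      I≢[] (suc (suc zero)) = I₂≢[]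

    subdivision-spanning : Spanning subdivision
    subdivision-spanning x with covers x
    ... | here eq          = inj₁ eq
    ... | there (here eq)  = inj₂ (inj₁ eq)
    ... | there (there x∈) with ∈-++⁻ I₀ x∈
    ...   | inj₁ x∈₀ = inj₂ (inj₂ (zero , x∈₀))
    ...   | inj₂ x∈₁₂ with ∈-++⁻ I₁ x∈₁₂
    ...     | inj₁ x∈₁ = inj₂ (inj₂ (suc zero , x∈₁))
    ...     | inj₂ x∈₂ = inj₂ (inj₂ (suc (suc zero) , x∈₂))

  no-middle-path : MiddleLess G → ∀ {u v I₀ I₁ I₂} (θ : SpanningTheta u v I₀ I₁ I₂) i →
                   ¬ IsMiddle (subdivision θ) i
  no-middle-path middleLess θ = proj₂ middleLess (subdivision θ) (subdivision-spanning θ)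

  subdivision⇒theta : (S : K23Subdiv G) → Spanning S →
    SpanningTheta (u S) (v S) (inner S zero) (inner S (suc zero)) (inner S (suc (suc zero)))
  subdivision⇒theta S spanning = record
    { path₀ = proj₁ (isPath S zero) ; path₁ = proj₁ (isPath S (suc zero))
    ; path₂ = proj₁ (isPath S (suc (suc zero)))
    ; I₀≢[] = nonEmpty S zero ; I₁≢[] = nonEmpty S (suc zero) ; I₂≢[] = nonEmpty S (suc (suc zero))
    ; unique = Unique.++⁺ ends-unique inner-unique ends∉inner
    ; covers = covers }
    where
    I₀ I₁ I₂ : List (Fin n)
    I₀ = inner S zero
    I₁ = inner S (suc zero)
    I₂ = inner S (suc (suc zero))
    inner⁻ : ∀ {x} → x ∈ I₀ ++ I₁ ++ I₂ → ∃[ i ] x ∈ inner S i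
    inner⁻ x∈ with ∈-++⁻ I₀ x∈
    ... | inj₁ x∈₀ = zero , x∈₀
    ... | inj₂ x∈₁₂ with ∈-++⁻ I₁ x∈₁₂
    ...   | inj₁ x∈₁ = suc zero , x∈₁
    ...   | inj₂ x∈₂ = suc (suc zero) , x∈₂
    path-unique : ∀ i → Unique (u S ∷ inner S i ++ [ v S ])
    path-unique i = proj₂ (isPath S i)
    u∉ : ∀ i → u S ∉ inner S i ++ [ v S ]
    u∉ i u∈ with path-unique i
    ... | u≢ ∷ _ = All.lookup u≢ u∈ refl
    v∉ : ∀ i → v S ∉ inner S i
    v∉ i v∈ with path-unique i
    ... | _ ∷ U = Unique-++⇒disjoint (inner S i) U v∈ (here refl)
    unique-inner : ∀ i → Unique (inner S i)
    unique-inner i with path-unique i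
    ... | _ ∷ U = Unique-++⁻ˡ (inner S i) U
    ends-unique : Unique (u S ∷ v S ∷ [])
    ends-unique = ((λ u≡v → u∉ zero (∈-++⁺ʳ I₀ (here u≡v))) ∷ []) ∷ [] ∷ []
    inner-unique : Unique (I₀ ++ I₁ ++ I₂)
    inner-unique = Unique.++⁺ (unique-inner zero)
      (Unique.++⁺ (unique-inner (suc zero)) (unique-inner (suc (suc zero)))
        (λ (p , q) → disjoint S (suc zero) (suc (suc zero)) (λ ()) _ p q))
      (λ (p , q) → [ disjoint S zero (suc zero) (λ ()) _ p , disjoint S zero (suc (suc zero)) (λ ()) _ p ]′
                     (∈-++⁻ I₁ q))
    ends∉inner : ∀ {z} → ¬ (z ∈ u S ∷ v S ∷ [] × z ∈ I₀ ++ I₁ ++ I₂)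
    ends∉inner (here refl         , z∈) = u∉ (proj₁ (inner⁻ z∈)) (∈-++⁺ˡ (proj₂ (inner⁻ z∈)))
    ends∉inner (there (here refl) , z∈) = v∉ (proj₁ (inner⁻ z∈)) (proj₂ (inner⁻ z∈))
    inner⁺ : ∀ {x} i → x ∈ inner S i → x ∈ I₀ ++ I₁ ++ I₂
    inner⁺ zero             x∈ = ∈-++⁺ˡ x∈
    inner⁺ (suc zero)       x∈ = ∈-++⁺ʳ I₀ (∈-++⁺ˡ x∈)
    inner⁺ (suc (suc zero)) x∈ = ∈-++⁺ʳ I₀ (∈-++⁺ʳ I₁ x∈)
    covers : ∀ x → x ∈ u S ∷ v S ∷ I₀ ++ I₁ ++ I₂
    covers x with spanning x
    ... | inj₁ refl            = here refl
    ... | inj₂ (inj₁ refl)     = there (here refl)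
    ... | inj₂ (inj₂ (i , x∈)) = there (there (inner⁺ i x∈))

  rerouted : ∀ {u v I₀ I₁ I₂ u′ v′ J₀ J₁ J₂} → SpanningTheta u v I₀ I₁ I₂ →
    Walk _~_ u′ J₀ v′ → Walk _~_ u′ J₁ v′ → Walk _~_ u′ J₂ v′ →
    J₀ ≢ [] → J₁ ≢ [] → J₂ ≢ [] →
    u ∷ v ∷ I₀ ++ I₁ ++ I₂ ↭ u′ ∷ v′ ∷ J₀ ++ J₁ ++ J₂ → SpanningTheta u′ v′ J₀ J₁ J₂
  rerouted θ p₀ p₁ p₂ n₀ n₁ n₂ σ = record
    { path₀ = p₀ ; path₁ = p₁ ; path₂ = p₂ ; I₀≢[] = n₀ ; I₁≢[] = n₁ ; I₂≢[] = n₂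
    ; unique = Unique-resp-↭ σ unique ; covers = ∈-resp-↭ σ ∘ covers }
    where open SpanningTheta θ

  swap₀₁ : ∀ {u v I₀ I₁ I₂} → SpanningTheta u v I₀ I₁ I₂ → SpanningTheta u v I₁ I₀ I₂
  swap₀₁ {u} {v} {I₀} {I₁} {I₂} θ = rerouted θ path₁ path₀ path₂ I₁≢[] I₀≢[] I₂≢[]
    (solve 5 (λ u v a b c → u ⊕ (v ⊕ (a ⊕ (b ⊕ c))) ⊜ u ⊕ (v ⊕ (b ⊕ (a ⊕ c))))
      ↭-refl [ u ] [ v ] I₀ I₁ I₂)
    where open SpanningTheta θ

  swap₀₂ : ∀ {u v I₀ I₁ I₂} → SpanningTheta u v I₀ I₁ I₂ → SpanningTheta u v I₂ I₁ I₀
  swap₀₂ {u} {v} {I₀} {I₁} {I₂} θ = rerouted θ path₂ path₁ path₀ I₂≢[] I₁≢[] I₀≢[]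
    (solve 5 (λ u v a b c → u ⊕ (v ⊕ (a ⊕ (b ⊕ c))) ⊜ u ⊕ (v ⊕ (c ⊕ (b ⊕ a))))
      ↭-refl [ u ] [ v ] I₀ I₁ I₂)
    where open SpanningTheta θ

  chord⇒K113-minor : ∀ {u v I₀ I₁ I₂} → SpanningTheta u v I₀ I₁ I₂ → ∀ X p w W q Y →
    u ∷ I₀ ++ [ v ] ≡ X ++ p ∷ w ∷ W ++ q ∷ Y → p ~ q → IsMinor K113 G
  chord⇒K113-minor {u} {v} {I₀} {I₁} {I₂} θ X p w W q Y split p~q =
    K113-minor unique′
      (Linked⇒Connected (Linked-prefix X walk)) (Linked⇒Connected q-Y) (Linked⇒Connected w-W)
      (Linked⇒Connected (Walk-inner I₁ path₁)) (Linked⇒Connected (Walk-inner I₂ path₂))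
      (p , q , p∈ , here refl , p~q) (p , w , p∈ , here refl , Linked-adjacent X walk)
      (from-u I₁≢[] path₁) (from-u I₂≢[] path₂) q-to-W (to-v I₁≢[] path₁) (to-v I₂≢[] path₂)
    where
    open SpanningTheta θ
    unique′ : Unique ((X ++ [ p ]) ++ (q ∷ Y) ++ (w ∷ W) ++ I₁ ++ I₂)
    unique′ = Unique-resp-↭
      (solve 7 (λ X p W q Y b c → (X ⊕ (p ⊕ (W ⊕ (q ⊕ Y)))) ⊕ (b ⊕ c) ⊜ (X ⊕ p) ⊕ ((q ⊕ Y) ⊕ (W ⊕ (b ⊕ c))))
        ↭-refl X [ p ] (w ∷ W) [ q ] Y I₁ I₂)
      (subst (λ P → Unique (P ++ I₁ ++ I₂)) split (unique-path₀-first θ))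
    walk : Linked _~_ (X ++ p ∷ w ∷ W ++ q ∷ Y)
    walk = subst (Linked _~_) split path₀
    p∈ : p ∈ X ++ [ p ]
    p∈ = ∈-++⁺ʳ X (here refl)
    q-Y : Linked _~_ (q ∷ Y)
    q-Y = Linked-++⁻ʳ (X ++ p ∷ w ∷ W) (subst (Linked _~_) (sym (++-∷-assoc X p (w ∷ W) (q ∷ Y))) walk)
    w-W : Linked _~_ (w ∷ W)
    w-W = Linked-++⁻ˡ (w ∷ W) (Linked.tail (Linked-++⁻ʳ X walk))
    q-to-W : Joined (q ∷ Y) (w ∷ W)
    q-to-W with Linked-predecessor W (Linked.tail (Linked-++⁻ʳ X walk))
    ... | z , z∈ , z~q = q , z , here refl , z∈ , symm G z~q
    v-split : (u ∷ I₀) ++ [ v ] ≡ (X ++ p ∷ w ∷ W) ++ q ∷ Y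
    v-split = trans split (sym (++-∷-assoc X p (w ∷ W) (q ∷ Y)))
    from-u : ∀ {I} → I ≢ [] → Walk _~_ u I v → Joined (X ++ [ p ]) I
    from-u = Walk⇒Joined-first (head∈prefix X split)
    to-v : ∀ {I} → I ≢ [] → Walk _~_ u I v → Joined (q ∷ Y) I
    to-v = Walk⇒Joined-last (last∈suffix (u ∷ I₀) (X ++ p ∷ w ∷ W) v-split)

  terminal-path-induced : ¬ IsMinor K113 G → ∀ {u v I₀ I₁ I₂} → SpanningTheta u v I₀ I₁ I₂ → ∀ {x y} →
    x ∈ u ∷ I₀ ++ [ v ] → y ∈ u ∷ I₀ ++ [ v ] → x ~ y → EdgeOfSeq (u ∷ I₀ ++ [ v ]) x y
  terminal-path-induced noK113 {u} {v} {I₀} θ {x} {y} x∈ y∈ x~y with ∈-ordered (u ∷ I₀ ++ [ v ]) x∈ y∈ x≢y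
    where
    x≢y : x ≢ y
    x≢y refl = irrefl G x~y
  ... | inj₁ (ordered X []      Y eq) = inj₁ (X , Y , eq)
  ... | inj₂ (ordered X []      Y eq) = inj₂ (X , Y , eq)
  ... | inj₁ (ordered X (w ∷ W) Y eq) = ⊥-elim (noK113 (chord⇒K113-minor θ X x w W y Y eq x~y))
  ... | inj₂ (ordered X (w ∷ W) Y eq) = ⊥-elim (noK113 (chord⇒K113-minor θ X y w W x Y eq (symm G x~y)))

  crossing-cross-edges⇒K1∪K23-minor : ∀ {u v A₁ c A₂ x A₃ B₁ y B₂ d B₃ I₂} →
    SpanningTheta u v (A₁ ++ c ∷ A₂ ++ x ∷ A₃) (B₁ ++ y ∷ B₂ ++ d ∷ B₃) I₂ → c ~ d → x ~ y → IsMinor K1∪K23 G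
  crossing-cross-edges⇒K1∪K23-minor {u} {v} {A₁} {c} {A₂} {x} {A₃} {B₁} {y} {B₂} {d} {B₃} {I₂} θ c~d x~y
    with Walk-split₂ A₁ A₂ (SpanningTheta.path₀ θ) | Walk-split₂ B₁ B₂ (SpanningTheta.path₁ θ)
  ... | uc , cx , xv | uy , yd , dv =
    K1∪K23-minor unique′ (here refl)
      (Connected-star (Linked⇒Connected (Walk-init A₁ uc))
        (Connected-star (Linked⇒Connected (Walk-init B₁ uy)) (Linked⇒Connected (Walk-init I₂ path₂))))
      (Linked⇒Connected [-]) (Linked⇒Connected [-])
      (Linked⇒Connected (Walk-init A₂ cx)) (Linked⇒Connected (Walk-init B₂ yd))
      (Connected-meet (Linked⇒Connected (Linked.tail xv)) (Linked⇒Connected (Linked.tail dv)))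
      (Walk⇒Joined-prev (here refl) cx) (x , y , here refl , here refl , x~y)
      (Joined-monoʳ (∈-++-∷⁺ˡ A₃) (Walk⇒Joined-next (here refl) xv))
      (d , c , here refl , here refl , symm G c~d) (Walk⇒Joined-prev (here refl) yd)
      (Joined-monoʳ (∈-++-∷⁺ʳ A₃) (Walk⇒Joined-next (here refl) dv))
    where
    open SpanningTheta θ
    unique′ : Unique ((u ∷ A₁ ++ B₁ ++ I₂) ++ [ x ] ++ [ d ] ++ (c ∷ A₂) ++ (y ∷ B₂) ++ (A₃ ++ v ∷ B₃))
    unique′ = Unique-resp-↭
      (solve 13 (λ u v A₁ c A₂ x A₃ B₁ y B₂ d B₃ I₂ →
          u ⊕ (v ⊕ ((A₁ ⊕ (c ⊕ (A₂ ⊕ (x ⊕ A₃)))) ⊕ ((B₁ ⊕ (y ⊕ (B₂ ⊕ (d ⊕ B₃)))) ⊕ I₂)))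
        ⊜ (u ⊕ (A₁ ⊕ (B₁ ⊕ I₂))) ⊕ (x ⊕ (d ⊕ ((c ⊕ A₂) ⊕ ((y ⊕ B₂) ⊕ (A₃ ⊕ (v ⊕ B₃)))))))
        ↭-refl [ u ] [ v ] A₁ [ c ] A₂ [ x ] A₃ B₁ [ y ] B₂ [ d ] B₃ I₂)
      unique

  module _ (middleLess : MiddleLess G) (noK1∪K23 : ¬ IsMinor K1∪K23 G) where

    -- If y is the last inner vertex of I₁, the walks u A₁ c A₂ x, u B₁ d B₂ y x and u I₂ v A₃⁻¹ x
    -- form a spanning subdivision whose second path is middle; otherwise the rest of I₁ after y
    -- is the K₁ of a K₁ ∪ K₂,₃ minor.
    parallel-cross-edges-impossible : ∀ {u v A₁ c A₂ x A₃ B₁ d B₂ y B₃ I₂} →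
      SpanningTheta u v (A₁ ++ c ∷ A₂ ++ x ∷ A₃) (B₁ ++ d ∷ B₂ ++ y ∷ B₃) I₂ → c ~ d → x ~ y → ⊥
    parallel-cross-edges-impossible {u} {v} {A₁} {c} {A₂} {x} {A₃} {B₁} {d} {B₂} {y} {[]} {I₂} θ c~d x~y
      with Walk-split₂ A₁ A₂ (SpanningTheta.path₀ θ) | Walk-split₂ B₁ B₂ (SpanningTheta.path₁ θ)
    ... | uc , cx , xv | ud , dy , yv = no-middle-path middleLess θ′ (suc zero) middle
      where
      open SpanningTheta θ
      θ′ : SpanningTheta u x (A₁ ++ c ∷ A₂) ((B₁ ++ d ∷ B₂) ++ [ y ]) (I₂ ++ v ∷ reverse A₃)
      θ′ = rerouted θ (Walk-join A₁ uc cx)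
        (Walk-join (B₁ ++ d ∷ B₂) (Walk-join B₁ ud dy) (symm G x~y ∷ [-]))
        (Walk-join I₂ path₂ (Walk-reverse (symm G) xv))
        (++-∷≢[] A₁) (++-∷≢[] (B₁ ++ d ∷ B₂)) (++-∷≢[] I₂)
        (↭-trans
          (solve 12 (λ u v A₁ c A₂ x A₃ B₁ d B₂ y I₂ →
              u ⊕ (v ⊕ ((A₁ ⊕ (c ⊕ (A₂ ⊕ (x ⊕ A₃)))) ⊕ ((B₁ ⊕ (d ⊕ (B₂ ⊕ y))) ⊕ I₂)))
            ⊜ u ⊕ (x ⊕ ((A₁ ⊕ (c ⊕ A₂)) ⊕ (((B₁ ⊕ (d ⊕ B₂)) ⊕ y) ⊕ (I₂ ⊕ (v ⊕ A₃))))))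
            ↭-refl [ u ] [ v ] A₁ [ c ] A₂ [ x ] A₃ B₁ [ d ] B₂ [ y ] I₂)
          (prep u (prep x (++⁺ˡ (A₁ ++ c ∷ A₂) (++⁺ˡ ((B₁ ++ d ∷ B₂) ++ [ y ])
            (++⁺ˡ I₂ (prep v (↭-sym (↭-reverse A₃)))))))))
      middle : IsMiddle (subdivision θ′) (suc zero)
      middle zero             _   = d , c , ∈-++⁺ˡ (∈-++⁺ʳ B₁ (here refl)) , ∈-++⁺ʳ A₁ (here refl) , symm G c~d
      middle (suc zero)       1≢1 = ⊥-elim (1≢1 refl)
      middle (suc (suc zero)) _   =
        y , v , ∈-++⁺ʳ (B₁ ++ d ∷ B₂) (here refl) , ∈-++⁺ʳ I₂ (here refl) , Linked-adjacent [] yv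
    parallel-cross-edges-impossible {u} {v} {A₁} {c} {A₂} {x} {A₃} {B₁} {d} {B₂} {y} {b ∷ B₃} {I₂} θ c~d x~y
      with Walk-split₂ A₁ A₂ (SpanningTheta.path₀ θ) | Walk-split₂ B₁ B₂ (SpanningTheta.path₁ θ)
    ... | uc , cx , xv | ud , dy , yv = noK1∪K23 (K1∪K23-minor unique′ (here refl)
        (Linked⇒Connected (Walk-inner (b ∷ B₃) yv)) (Linked⇒Connected [-]) (Linked⇒Connected [-])
        (Linked⇒Connected (Walk-inner (A₁ ++ c ∷ A₂) (Walk-join A₁ uc cx)))
        (Linked⇒Connected (Linked.tail (Walk-join B₁ ud dy)))
        (Connected-meet (Linked⇒Connected (Linked.tail path₂)) (Linked⇒Connected (Linked.tail xv)))
        (Joined-monoʳ (∈-++-∷⁺ˡ A₁) (Walk⇒Joined-next (here refl) uc))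
        (Joined-monoʳ (∈-++⁺ˡ ∘ ∈-++-∷⁺ˡ B₁) (Walk⇒Joined-next (here refl) ud))
        (Joined-monoʳ ∈-++⁺ˡ (Walk⇒Joined-first (here refl) I₂≢[] path₂))
        (Joined-monoʳ (∈-++⁺ʳ A₁) (Walk⇒Joined-prev (here refl) cx))
        (x , y , here refl , ∈-++⁺ʳ (B₁ ++ d ∷ B₂) (here refl) , x~y)
        (Joined-monoʳ (∈-++-∷⁺ʳ I₂) (Walk⇒Joined-next (here refl) xv)))
      where
      open SpanningTheta θ
      unique′ : Unique ((b ∷ B₃) ++ [ u ] ++ [ x ] ++ (A₁ ++ c ∷ A₂) ++ ((B₁ ++ d ∷ B₂) ++ [ y ]) ++ (I₂ ++ v ∷ A₃))
      unique′ = Unique-resp-↭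
        (solve 13 (λ u v A₁ c A₂ x A₃ B₁ d B₂ y B₃ I₂ →
            u ⊕ (v ⊕ ((A₁ ⊕ (c ⊕ (A₂ ⊕ (x ⊕ A₃)))) ⊕ ((B₁ ⊕ (d ⊕ (B₂ ⊕ (y ⊕ B₃)))) ⊕ I₂)))
          ⊜ B₃ ⊕ (u ⊕ (x ⊕ ((A₁ ⊕ (c ⊕ A₂)) ⊕ (((B₁ ⊕ (d ⊕ B₂)) ⊕ y) ⊕ (I₂ ⊕ (v ⊕ A₃)))))))
          ↭-refl [ u ] [ v ] A₁ [ c ] A₂ [ x ] A₃ B₁ [ d ] B₂ [ y ] (b ∷ B₃) I₂)
        unique

    -- If c is the last inner vertex of I₀, the walks u A₁ c y, u B₁ d B₂ y and u I₂ v B₃⁻¹ y form a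
    -- spanning subdivision whose first path is middle; otherwise the rest of I₀ after c is the K₁
    -- of a K₁ ∪ K₂,₃ minor.
    adjacent-cross-edges-impossible : ∀ {u v A₁ c A₂ B₁ d B₂ y B₃ I₂} →
      SpanningTheta u v (A₁ ++ c ∷ A₂) (B₁ ++ d ∷ B₂ ++ y ∷ B₃) I₂ → c ~ d → c ~ y → ⊥
    adjacent-cross-edges-impossible {u} {v} {A₁} {c} {[]} {B₁} {d} {B₂} {y} {B₃} {I₂} θ c~d c~y
      with Walk-split A₁ (SpanningTheta.path₀ θ) | Walk-split₂ B₁ B₂ (SpanningTheta.path₁ θ)
    ... | uc , cv | ud , dy , yv = no-middle-path middleLess θ′ zero middle
      where
      open SpanningTheta θ
      θ′ : SpanningTheta u y (A₁ ++ [ c ]) (B₁ ++ d ∷ B₂) (I₂ ++ v ∷ reverse B₃)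
      θ′ = rerouted θ (Walk-join A₁ uc (c~y ∷ [-])) (Walk-join B₁ ud dy)
        (Walk-join I₂ path₂ (Walk-reverse (symm G) yv))
        (++-∷≢[] A₁) (++-∷≢[] B₁) (++-∷≢[] I₂)
        (↭-trans
          (solve 10 (λ u v A₁ c B₁ d B₂ y B₃ I₂ →
              u ⊕ (v ⊕ ((A₁ ⊕ c) ⊕ ((B₁ ⊕ (d ⊕ (B₂ ⊕ (y ⊕ B₃)))) ⊕ I₂)))
            ⊜ u ⊕ (y ⊕ ((A₁ ⊕ c) ⊕ ((B₁ ⊕ (d ⊕ B₂)) ⊕ (I₂ ⊕ (v ⊕ B₃))))))
            ↭-refl [ u ] [ v ] A₁ [ c ] B₁ [ d ] B₂ [ y ] B₃ I₂)
          (prep u (prep y (++⁺ˡ (A₁ ++ [ c ]) (++⁺ˡ (B₁ ++ d ∷ B₂)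
            (++⁺ˡ I₂ (prep v (↭-sym (↭-reverse B₃)))))))))
      middle : IsMiddle (subdivision θ′) zero
      middle zero             0≢0 = ⊥-elim (0≢0 refl)
      middle (suc zero)       _   = c , d , ∈-++⁺ʳ A₁ (here refl) , ∈-++⁺ʳ B₁ (here refl) , c~d
      middle (suc (suc zero)) _   = c , v , ∈-++⁺ʳ A₁ (here refl) , ∈-++⁺ʳ I₂ (here refl) , Linked-adjacent [] cv
    adjacent-cross-edges-impossible {u} {v} {A₁} {c} {a ∷ A₂} {B₁} {d} {B₂} {y} {B₃} {I₂} θ c~d c~y
      with Walk-split A₁ (SpanningTheta.path₀ θ) | Walk-split₂ B₁ B₂ (SpanningTheta.path₁ θ)
    ... | uc , cv | ud , dy , yv = noK1∪K23 (K1∪K23-minor unique′ (here refl)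
        (Linked⇒Connected (Walk-inner (a ∷ A₂) cv)) (Linked⇒Connected [-]) (Linked⇒Connected [-])
        (Linked⇒Connected (Linked.tail uc)) (Linked⇒Connected (Walk-inner (B₁ ++ d ∷ B₂) (Walk-join B₁ ud dy)))
        (Connected-meet (Linked⇒Connected (Linked.tail path₂)) (Linked⇒Connected (Linked.tail yv)))
        (Walk⇒Joined-next (here refl) uc)
        (Joined-monoʳ (∈-++-∷⁺ˡ B₁) (Walk⇒Joined-next (here refl) ud))
        (Joined-monoʳ ∈-++⁺ˡ (Walk⇒Joined-first (here refl) I₂≢[] path₂))
        (y , c , here refl , ∈-++⁺ʳ A₁ (here refl) , symm G c~y)
        (Joined-monoʳ (∈-++⁺ʳ B₁) (Walk⇒Joined-prev (here refl) dy))
        (Joined-monoʳ (∈-++-∷⁺ʳ I₂) (Walk⇒Joined-next (here refl) yv)))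
      where
      open SpanningTheta θ
      unique′ : Unique ((a ∷ A₂) ++ [ u ] ++ [ y ] ++ (A₁ ++ [ c ]) ++ (B₁ ++ d ∷ B₂) ++ (I₂ ++ v ∷ B₃))
      unique′ = Unique-resp-↭
        (solve 11 (λ u v A₁ c A₂ B₁ d B₂ y B₃ I₂ →
            u ⊕ (v ⊕ ((A₁ ⊕ (c ⊕ A₂)) ⊕ ((B₁ ⊕ (d ⊕ (B₂ ⊕ (y ⊕ B₃)))) ⊕ I₂)))
          ⊜ A₂ ⊕ (u ⊕ (y ⊕ ((A₁ ⊕ c) ⊕ ((B₁ ⊕ (d ⊕ B₂)) ⊕ (I₂ ⊕ (v ⊕ B₃)))))))
          ↭-refl [ u ] [ v ] A₁ [ c ] (a ∷ A₂) B₁ [ d ] B₂ [ y ] B₃ I₂)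
        unique

    no-vertex-with-two-cross-edges : ∀ {u v I₀ I₁ I₂ c d y} → SpanningTheta u v I₀ I₁ I₂ →
      c ∈ I₀ → d ∈ I₁ → y ∈ I₁ → d ≢ y → c ~ d → c ~ y → ⊥
    no-vertex-with-two-cross-edges {I₁ = I₁} θ c∈ d∈ y∈ d≢y c~d c~y with ∈-∃++ c∈ | ∈-ordered I₁ d∈ y∈ d≢y
    ... | A₁ , A₂ , refl | inj₁ (ordered B₁ B₂ B₃ refl) = adjacent-cross-edges-impossible θ c~d c~y
    ... | A₁ , A₂ , refl | inj₂ (ordered B₁ B₂ B₃ refl) = adjacent-cross-edges-impossible θ c~y c~d

    disjoint-cross-edges-impossible : ∀ {u v I₀ I₁ I₂ c x d y} → SpanningTheta u v I₀ I₁ I₂ →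
      Ordered I₀ c x → d ∈ I₁ → y ∈ I₁ → d ≢ y → c ~ d → x ~ y → ⊥
    disjoint-cross-edges-impossible {I₁ = I₁} θ (ordered A₁ A₂ A₃ refl) d∈ y∈ d≢y c~d x~y
      with ∈-ordered I₁ d∈ y∈ d≢y
    ... | inj₁ (ordered B₁ B₂ B₃ refl) = parallel-cross-edges-impossible θ c~d x~y
    ... | inj₂ (ordered B₁ B₂ B₃ refl) = noK1∪K23 (crossing-cross-edges⇒K1∪K23-minor θ c~d x~y)

    cross-edges-equal : ∀ {u v I₀ I₁ I₂ c d x y} → SpanningTheta u v I₀ I₁ I₂ →
      c ∈ I₀ → d ∈ I₁ → x ∈ I₀ → y ∈ I₁ → c ~ d → x ~ y → c ≡ x × d ≡ y
    cross-edges-equal {I₀ = I₀} {c = c} {d} {x} {y} θ c∈ d∈ x∈ y∈ c~d x~y with c ≟ x | d ≟ y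
    ... | yes refl | yes refl = refl , refl
    ... | yes refl | no d≢y   = ⊥-elim (no-vertex-with-two-cross-edges θ c∈ d∈ y∈ d≢y c~d x~y)
    ... | no c≢x   | yes refl =
      ⊥-elim (no-vertex-with-two-cross-edges (swap₀₁ θ) d∈ c∈ x∈ c≢x (symm G c~d) (symm G x~y))
    ... | no c≢x   | no d≢y   with ∈-ordered I₀ c∈ x∈ c≢x
    ...   | inj₁ c≺x = ⊥-elim (disjoint-cross-edges-impossible θ c≺x d∈ y∈ d≢y c~d x~y)
    ...   | inj₂ x≺c = ⊥-elim (disjoint-cross-edges-impossible θ x≺c y∈ d∈ (d≢y ∘ sym) x~y c~d)

module TerminalPaths {n : ℕ} {G : Graph n} (noK113 : ¬ IsMinor K113 G) (S : K23Subdiv G) (spanning : Spanning S) where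

  private
    θ : SpanningTheta G (u S) (v S) (inner S zero) (inner S (suc zero)) (inner S (suc (suc zero)))
    θ = subdivision⇒theta G S spanning

  terminal-paths-induced : ∀ i {x y} → x ∈ tpath S i → y ∈ tpath S i → adj G x y → EdgeOfSeq (tpath S i) x y
  terminal-paths-induced zero             = terminal-path-induced G noK113 θ
  terminal-paths-induced (suc zero)       = terminal-path-induced G noK113 (swap₀₁ G θ)
  terminal-paths-induced (suc (suc zero)) = terminal-path-induced G noK113 (swap₀₂ G θ)

  terminal-or-inner : ∀ i {x} → x ∈ tpath S i → (∀ j → x ∈ tpath S j) ⊎ x ∈ inner S i
  terminal-or-inner i (here refl) = inj₁ (λ _ → here refl)
  terminal-or-inner i (there x∈) with ∈-++⁻ (inner S i) x∈
  ... | inj₁ x∈I         = inj₂ x∈I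
  ... | inj₂ (here refl) = inj₁ (λ j → there (∈-++⁺ʳ (inner S j) (here refl)))

  CrossEdge : Fin 3 → Fin 3 → Fin n → Fin n → Set
  CrossEdge i j x y = (x ∈ inner S i × y ∈ inner S j) ⊎ (x ∈ inner S j × y ∈ inner S i)

  edge-of-union-of-two-paths : ∀ i j {x y} → adj G x y → InPaths S i j x → InPaths S i j y →
    EdgeOfSeq (tpath S i) x y ⊎ EdgeOfSeq (tpath S j) x y ⊎ CrossEdge i j x y
  edge-of-union-of-two-paths i j e (inj₁ x∈) (inj₁ y∈) = inj₁ (terminal-paths-induced i x∈ y∈ e)
  edge-of-union-of-two-paths i j e (inj₂ x∈) (inj₂ y∈) = inj₂ (inj₁ (terminal-paths-induced j x∈ y∈ e))
  edge-of-union-of-two-paths i j e (inj₁ x∈) (inj₂ y∈) with terminal-or-inner i x∈ | terminal-or-inner j y∈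
  ... | inj₁ x∈all | _          = inj₂ (inj₁ (terminal-paths-induced j (x∈all j) y∈ e))
  ... | inj₂ _     | inj₁ y∈all = inj₁ (terminal-paths-induced i x∈ (y∈all i) e)
  ... | inj₂ x∈I   | inj₂ y∈J   = inj₂ (inj₂ (inj₁ (x∈I , y∈J)))
  edge-of-union-of-two-paths i j e (inj₂ x∈) (inj₁ y∈) with terminal-or-inner j x∈ | terminal-or-inner i y∈
  ... | inj₁ x∈all | _          = inj₁ (terminal-paths-induced i (x∈all i) y∈ e)
  ... | inj₂ _     | inj₁ y∈all = inj₂ (inj₁ (terminal-paths-induced j x∈ (y∈all j) e))
  ... | inj₂ x∈J   | inj₂ y∈I   = inj₂ (inj₂ (inj₂ (x∈J , y∈I)))

  cross-edge : ∀ i j {x y} → adj G x y → InPaths S i j x → InPaths S i j y →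
    ¬ EdgeOfSeq (tpath S i) x y → ¬ EdgeOfSeq (tpath S j) x y → CrossEdge i j x y
  cross-edge i j e x∈ y∈ ∉Pᵢ ∉Pⱼ with edge-of-union-of-two-paths i j e x∈ y∈
  ... | inj₁ ∈Pᵢ        = ⊥-elim (∉Pᵢ ∈Pᵢ)
  ... | inj₂ (inj₁ ∈Pⱼ) = ⊥-elim (∉Pⱼ ∈Pⱼ)
  ... | inj₂ (inj₂ c)   = c

  CrossEdge⇒Joined : ∀ {i j x y} → adj G x y → CrossEdge i j x y → Joined G (inner S i) (inner S j)
  CrossEdge⇒Joined x~y (inj₁ (x∈ , y∈)) = _ , _ , x∈ , y∈ , x~y
  CrossEdge⇒Joined x~y (inj₂ (x∈ , y∈)) = _ , _ , y∈ , x∈ , symm G x~y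

  module _ (middleLess : MiddleLess G) (noK1∪K23 : ¬ IsMinor K1∪K23 G) where

    cross-edge⇒induced-union : ∀ {a b} → adj G a b → CrossEdge zero (suc zero) a b →
      InducedIsUnion S (suc zero) (suc (suc zero))
    cross-edge⇒induced-union a~b ab x y x~y x∈ y∈
      with edge-of-union-of-two-paths (suc zero) (suc (suc zero)) x~y x∈ y∈
    ... | inj₁ edge        = inj₁ edge
    ... | inj₂ (inj₁ edge) = inj₂ edge
    ... | inj₂ (inj₂ xy)   = ⊥-elim (proj₂ middleLess S spanning (suc zero) middle)
      where
      middle : IsMiddle S (suc zero)
      middle zero             _   = Joined-sym G (CrossEdge⇒Joined a~b ab)
      middle (suc zero)       1≢1 = ⊥-elim (1≢1 refl)
      middle (suc (suc zero)) _   = CrossEdge⇒Joined x~y xy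

    cross-edges-coincide : ∀ {a b x y} → adj G a b → adj G x y →
      CrossEdge zero (suc zero) a b → CrossEdge zero (suc zero) x y → (x ≡ a × y ≡ b) ⊎ (x ≡ b × y ≡ a)
    cross-edges-coincide a~b x~y (inj₁ (a∈ , b∈)) (inj₁ (x∈ , y∈)) =
      inj₁ (cross-edges-equal G middleLess noK1∪K23 θ x∈ y∈ a∈ b∈ x~y a~b)
    cross-edges-coincide a~b x~y (inj₁ (a∈ , b∈)) (inj₂ (x∈ , y∈)) =
      inj₂ (swap (cross-edges-equal G middleLess noK1∪K23 θ y∈ x∈ a∈ b∈ (symm G x~y) a~b))
    cross-edges-coincide a~b x~y (inj₂ (a∈ , b∈)) (inj₁ (x∈ , y∈)) =
      inj₂ (cross-edges-equal G middleLess noK1∪K23 θ x∈ y∈ b∈ a∈ x~y (symm G a~b))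
    cross-edges-coincide a~b x~y (inj₂ (a∈ , b∈)) (inj₂ (x∈ , y∈)) =
      inj₁ (swap (cross-edges-equal G middleLess noK1∪K23 θ y∈ x∈ b∈ a∈ (symm G x~y) (symm G a~b)))

lemma3 : ∀ {n} (G : Graph n) → MiddleLess G → ¬ IsMinor K113 G → ¬ IsMinor K1∪K23 G →
    (S : K23Subdiv G) → Spanning S →
    (a b : Fin n) → adj G a b → InPaths S zero (suc zero) a → InPaths S zero (suc zero) b →
    ¬ EdgeOfSeq (tpath S zero) a b → ¬ EdgeOfSeq (tpath S (suc zero)) a b →
    (InducedIsUnion S (suc zero) (suc (suc zero)) ⊎ InducedIsUnion S (suc (suc zero)) zero)
    × (∀ (x y : Fin n) → adj G x y → InPaths S zero (suc zero) x → InPaths S zero (suc zero) y →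
         ¬ EdgeOfSeq (tpath S zero) x y → ¬ EdgeOfSeq (tpath S (suc zero)) x y →
         ¬ EdgeOfSeq (tpath S (suc (suc zero))) x y →
         (x ≡ a × y ≡ b) ⊎ (x ≡ b × y ≡ a))
lemma3 G middleLess noK113 noK1∪K23 S spanning a b a~b a∈ b∈ ab∉P₁ ab∉P₂ =
  inj₁ (cross-edge⇒induced-union middleLess noK1∪K23 a~b ab) ,
  λ x y x~y x∈ y∈ xy∉P₁ xy∉P₂ _ →
    cross-edges-coincide middleLess noK1∪K23 a~b x~y ab (cross-edge zero (suc zero) x~y x∈ y∈ xy∉P₁ xy∉P₂)
  where
  open TerminalPaths noK113 S spanning
  ab : CrossEdge zero (suc zero) a b
  ab = cross-edge zero (suc zero) a~b a∈ b∈ ab∉P₁ ab∉P₂
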